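{- Let $n\ge 2$ and $m\ge 0$, and let $F\colon\mathbb{Z}^{m+n}\to\mathbb{Z}$ be a linear map. Let $\sigma$ be an additive simplex of $\mathcal{BA}_n^m$ having a vertex $\langle w\rangle$ with $F(w)=N>0$. Then there exists a simplicial retraction $\pi\colon\mathrm{Link}_{\mathcal{BA}_n^m}(\sigma)\to\mathrm{Link}_{\mathcal{BA}_n^m}(\sigma)^{<N}$.
   Context: A line in $\mathbb{Z}^N$ is a set $\{v,-v\}$ with $v$ primitive, written $\langle v\rangle$. A frame is a set of lines $\{\langle v_1\rangle,\ldots,\langle v_N\rangle\}$ with $\{v_1,\ldots,v_N\}$ a basis of $\mathbb{Z}^N$; an augmented frame is $\{\langle v_0\rangle,\ldots,\langle v_N\rangle\}$ with $\{\langle v_1\rangle,\ldots,\langle v_N\rangle\}$ a frame and $\pm v_0\pm v_1\pm v_2=0$ for some signs; a partial augmented frame is a set of lines that can be completed to an augmented frame. $\mathcal{BA}_N$ is the simplicial complex of partial augmented frames for $\mathbb{Z}^N$. With $e_1,\ldots,e_{m+n}$ the standard basis, $\mathcal{BA}_n^m$ is the full subcomplex of $\mathrm{Link}_{\mathcal{BA}_{m+n}}(\{\langle e_1\rangle,\ldots,\langle e_m\rangle\})$ spanned by vertices $\langle v\rangle$ with $v\notin\mathrm{Span}_{\mathbb{Z}}(e_1,\ldots,e_m)$. A simplex of $\mathcal{BA}_n^m$ is standard if it is $\{\langle v_1\rangle,\ldots,\langle v_p\rangle\}$ with $\{e_1,\ldots,e_m,v_1,\ldots,v_p\}$ a basis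 of a direct summand of $\mathbb{Z}^{m+n}$; it is additive if it can be written $\{\langle v_0\rangle,\ldots,\langle v_p\rangle\}$ with $\{\langle v_1\rangle,\ldots,\langle v_p\rangle\}$ standard and either $\pm v_0\pm v_1\pm v_2=0$ (internally additive) or $\pm v_0\pm v_1\pm e_i=0$ for some $1\le i\le m$ (externally additive), for some choice of signs. For a subcomplex $X$ of $\mathcal{BA}_n^m$, $X^{<N}$ is the full subcomplex spanned by vertices $\langle v\rangle$ with $|F(v)|<N$. -}

module Defs where

open import Data.Nat as ℕ using (ℕ; zero; suc)
open import Data.Integer as ℤ using (ℤ; +_; 0ℤ; 1ℤ; -1ℤ; _*_; _+_; -_; ∣_∣)
open import Data.Fin as Fin using (Fin; _↑ˡ_)
open import Data.Vec as Vec using (Vec; []; _∷_; replicate; zipWith; lookup; tabulate; toList)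
open import Data.List as List using (List; [_])
open import Data.List.Membership.Propositional using (_∈_)
open import Data.List.Relation.Unary.All using (All)
open import Data.Product using (Σ; ∃; ∃-syntax; _×_; _,_)
open import Data.Sum using (_⊎_)
open import Data.Bool using (if_then_else_)
open import Relation.Binary.PropositionalEquality using (_≡_; _≢_)
open import Relation.Nullary using (¬_; does)

ℤ^ : ℕ → Set
ℤ^ d = Vec ℤ d

0v : ∀ {d} → ℤ^ d
0v = replicate _ 0ℤ

infixl 6 _⊕_
infixr 7 _·_

_⊕_ : ∀ {d} → ℤ^ d → ℤ^ d → ℤ^ d
_⊕_ = zipWith _+_

_·_ : ∀ {d} → ℤ → ℤ^ d → ℤ^ d
k · v = Vec.map (k *_) v

neg : ∀ {d} → ℤ^ d → ℤ^ d
neg = Vec.map -_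

lincomb : ∀ {d p} → Vec (ℤ^ d) p → Vec ℤ p → ℤ^ d
lincomb []       []       = 0v
lincomb (b ∷ bs) (c ∷ cs) = c · b ⊕ lincomb bs cs

std : ∀ {d} → Fin d → ℤ^ d
std k = tabulate (λ j → if does (j Fin.≟ k) then 1ℤ else 0ℤ)

IsLinear : ∀ {d} → (ℤ^ d → ℤ) → Set
IsLinear F = (∀ u v → F (u ⊕ v) ≡ F u + F v) × (∀ k v → F (k · v) ≡ k * F v)

IsPrimitive : ∀ {d} → ℤ^ d → Set
IsPrimitive {d} v = ∀ (k : ℤ) (u : ℤ^ d) → v ≡ k · u → (k ≡ 1ℤ ⊎ k ≡ -1ℤ)

-- ⟨v⟩ = ⟨w⟩, i.e. {v,-v} = {w,-w}
SameLine : ∀ {d} → ℤ^ d → ℤ^ d → Set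
SameLine v w = v ≡ w ⊎ v ≡ neg w

IsBasis : ∀ {d p} → Vec (ℤ^ d) p → Set
IsBasis {d} {p} bs =
  (∀ (x : ℤ^ d) → ∃[ c ] lincomb bs c ≡ x) ×
  (∀ (c : Vec ℤ p) → lincomb bs c ≡ 0v → c ≡ replicate _ 0ℤ)

IsSummandBasis : ∀ {d p} → Vec (ℤ^ d) p → Set
IsSummandBasis {d} bs = ∃[ q ] Σ (Vec (ℤ^ d) q) (λ ws → IsBasis (bs Vec.++ ws))

IsUnit : ℤ → Set
IsUnit s = s ≡ 1ℤ ⊎ s ≡ -1ℤ

SignedSumZero : ∀ {d} → ℤ^ d → ℤ^ d → ℤ^ d → Set
SignedSumZero a b c =
  ∃[ s₀ ] ∃[ s₁ ] ∃[ s₂ ]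
    (IsUnit s₀ × IsUnit s₁ × IsUnit s₂ × (s₀ · a ⊕ s₁ · b ⊕ s₂ · c ≡ 0v))

-- Finite sets of lines, represented by lists of representatives

_∈ₗ_ : ∀ {d} → ℤ^ d → List (ℤ^ d) → Set
v ∈ₗ L = ∃[ u ] (u ∈ L × SameLine u v)

_⊆ₗ_ : ∀ {d} → List (ℤ^ d) → List (ℤ^ d) → Set
L ⊆ₗ K = ∀ {v} → v ∈ L → v ∈ₗ K

_≈ₗ_ : ∀ {d} → List (ℤ^ d) → List (ℤ^ d) → Set
L ≈ₗ K = L ⊆ₗ K × K ⊆ₗ L

Disjointₗ : ∀ {d} → List (ℤ^ d) → List (ℤ^ d) → Set
Disjointₗ L K = ∀ v → v ∈ₗ L → ¬ (v ∈ₗ K)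

IsAugFrame : ∀ {N} → ℤ^ N → Vec (ℤ^ N) N → Set
IsAugFrame {N} v₀ vs =
  IsBasis vs ×
  ∃[ i ] ∃[ j ] (i ≢ j × SignedSumZero v₀ (lookup vs i) (lookup vs j))

IsPartialAugFrame : ∀ {N} → List (ℤ^ N) → Set
IsPartialAugFrame {N} L =
  All IsPrimitive L ×
  ∃[ v₀ ] Σ (Vec (ℤ^ N) N) (λ vs → IsAugFrame v₀ vs × L ⊆ₗ (v₀ List.∷ toList vs))

es : (m n : ℕ) → Vec (ℤ^ (m ℕ.+ n)) m
es m n = tabulate (λ i → std (i ↑ˡ n))

NotInSpanE : (m n : ℕ) → ℤ^ (m ℕ.+ n) → Set
NotInSpanE m n v = ¬ (∃[ c ] lincomb (es m n) c ≡ v)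

BA : (m n : ℕ) → List (ℤ^ (m ℕ.+ n)) → Set
BA m n L = All (NotInSpanE m n) L × IsPartialAugFrame (L List.++ toList (es m n))

IsStandard : (m n : ℕ) → List (ℤ^ (m ℕ.+ n)) → Set
IsStandard m n L =
  ∃[ p ] Σ (Vec (ℤ^ (m ℕ.+ n)) p)
    (λ vs → (L ≈ₗ toList vs) × IsSummandBasis (es m n Vec.++ vs))

IsAdditive : (m n : ℕ) → List (ℤ^ (m ℕ.+ n)) → Set
IsAdditive m n L =
  ∃[ p ] ∃[ v₀ ] Σ (Vec (ℤ^ (m ℕ.+ n)) p) (λ vs →
    (L ≈ₗ (v₀ List.∷ toList vs)) ×
    IsStandard m n (toList vs) ×
    ( (∃[ i ] ∃[ j ] (i ≢ j × SignedSumZero v₀ (lookup vs i) (lookup vs j)))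
    ⊎ (∃[ i ] ∃[ k ] SignedSumZero v₀ (lookup vs i) (lookup (es m n) k))))

-- Links, X^{<N}, simplicial retractions  (complexes = predicates on
-- finite lists of line representatives)

Link : ∀ {d} → (List (ℤ^ d) → Set) → List (ℤ^ d) → List (ℤ^ d) → Set
Link X σ τ = X (τ List.++ σ) × Disjointₗ τ σ

Below : ∀ {d} → (ℤ^ d → ℤ) → ℕ → (List (ℤ^ d) → Set) → List (ℤ^ d) → Set
Below F N X τ = X τ × All (λ v → ∣ F v ∣ ℕ.< N) τ

IsSimplicialRetraction : ∀ {d} → (List (ℤ^ d) → Set) → (List (ℤ^ d) → Set)
                         → (ℤ^ d → ℤ^ d) → Set
IsSimplicialRetraction X Y π =
  (∀ v w → X [ v ] → SameLine v w → SameLine (π v) (π w)) ×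
  (∀ τ → X τ → Y (List.map π τ)) ×
  (∀ v → Y [ v ] → SameLine (π v) v)

module Submission where

-- Write D = m + n and E = {e₁,…,e_m}.  Since F(w) = N > 0,
-- every vertex v can be moved into the strip |F| < N along ⟨w⟩:
--     π(v) = v + q(F v) · w ,
-- where q is the symmetric integer quotient by N (so |F v + q(F v)·N| < N,
-- q is odd and vanishes on the strip).  π is odd, hence defined on lines, and
-- is the identity on the strip.  The substance is that π is simplicial.  A
-- simplex τ of the link lies, together with σ and E, in an augmented frame
-- {⟨v₀⟩,⟨b₁⟩,…,⟨b_D⟩} with v₀ = ±bᵢ ± bⱼ.  The only signed relation
-- ±x ± y ± z = 0 among lines of such a frame is the one on {v₀,bᵢ,bⱼ}
-- ("relation rigidity"); as σ is additive, σ ∪ E carries such a relation, so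
-- v₀, bᵢ, bⱼ all lie in σ ∪ E.  Consequently w ∈ σ has vanishing coordinate
-- along every bₖ outside σ ∪ E, and the "sheared" vectors bₖ + γₖ w form a
-- new basis, where γₖ = q(F bₖ) off σ ∪ E and γₖ = 0 on it.  The vertices of
-- τ are (up to sign) the bₖ off σ ∪ E, which are sent by π to the sheared
-- bₖ, so π(τ) ∪ σ ∪ E lies in the augmented frame {v₀, b₁+γ₁w, …}.

open import Defs

module IntegerUnits where
  open import Data.Integer using (ℤ; +_; -[1+_]; 0ℤ; 1ℤ; _*_; _+_; -_; ∣_∣)
  import Data.Integer.Properties as ℤP
  import Data.Nat.Properties as ℕP
  open import Data.Integer.Tactic.RingSolver using (solve-∀)
  open import Data.Sum using (inj₁; inj₂)
  open import Relation.Binary.PropositionalEquality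

  unit≢0 : ∀ {a} → IsUnit a → a ≢ 0ℤ
  unit≢0 (inj₁ refl) ()
  unit≢0 (inj₂ refl) ()

  unit-* : ∀ {a b} → IsUnit a → IsUnit b → IsUnit (a * b)
  unit-* (inj₁ refl) (inj₁ refl) = inj₁ refl
  unit-* (inj₁ refl) (inj₂ refl) = inj₂ refl
  unit-* (inj₂ refl) (inj₁ refl) = inj₂ refl
  unit-* (inj₂ refl) (inj₂ refl) = inj₁ refl

  unit-neg : ∀ {a} → IsUnit a → IsUnit (- a)
  unit-neg (inj₁ refl) = inj₂ refl
  unit-neg (inj₂ refl) = inj₁ refl

  unit-square : ∀ {a} → IsUnit a → a * a ≡ 1ℤ
  unit-square (inj₁ refl) = refl
  unit-square (inj₂ refl) = refl

  *≡1⇒unit : ∀ a b → a * b ≡ 1ℤ → IsUnit a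
  *≡1⇒unit a b eq with ℕP.m*n≡1⇒m≡1 ∣ a ∣ ∣ b ∣ (trans (sym (ℤP.abs-* a b)) (cong ∣_∣ eq))
  *≡1⇒unit (+ .1)     b eq | refl = inj₁ refl
  *≡1⇒unit -[1+ .0 ] b eq | refl = inj₂ refl

  unit-cancel : ∀ {a} x → IsUnit a → a * x ≡ 0ℤ → x ≡ 0ℤ
  unit-cancel {a} x ua ax≡0 = begin
    x             ≡⟨ sym (ℤP.*-identityˡ x) ⟩
    1ℤ * x        ≡⟨ cong (_* x) (sym (unit-square ua)) ⟩
    (a * a) * x   ≡⟨ ℤP.*-assoc a a x ⟩
    a * (a * x)   ≡⟨ cong (a *_) ax≡0 ⟩
    a * 0ℤ        ≡⟨ ℤP.*-zeroʳ a ⟩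
    0ℤ            ∎
    where open ≡-Reasoning

  unit-solve : ∀ {a b} x → IsUnit a → IsUnit b → a * x + b ≡ 0ℤ → IsUnit x
  unit-solve {a} {b} x ua ub eq = subst IsUnit (sym x≡-ab) (unit-neg (unit-* ua ub))
    where
    open ≡-Reasoning
    expand : ∀ a x b → (a * a) * x ≡ a * (a * x + b) + - (a * b)
    expand = solve-∀
    x≡-ab : x ≡ - (a * b)
    x≡-ab = begin
      x                              ≡⟨ sym (ℤP.*-identityˡ x) ⟩
      1ℤ * x                         ≡⟨ cong (_* x) (sym (unit-square ua)) ⟩
      (a * a) * x                    ≡⟨ expand a x b ⟩
      a * (a * x + b) + - (a * b)    ≡⟨ cong (λ e → a * e + - (a * b)) eq ⟩
      a * 0ℤ + - (a * b)             ≡⟨ cong (_+ - (a * b)) (ℤP.*-zeroʳ a) ⟩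
      0ℤ + - (a * b)                 ≡⟨ ℤP.+-identityˡ _ ⟩
      - (a * b)                      ∎

  -- Combinations  a x + b y + c z  with unit coefficients a, b, c; they are
  -- the coordinates of a signed relation  ±x ± y ± z = 0.
  combo : ℤ → ℤ → ℤ → ℤ → ℤ → ℤ → ℤ
  combo a b c x y z = a * x + b * y + c * z

  -- the sum of three units is odd, hence non-zero
  combo-units≢0 : ∀ {a b c x y z} → IsUnit a → IsUnit b → IsUnit c →
                  IsUnit x → IsUnit y → IsUnit z → combo a b c x y z ≢ 0ℤ
  combo-units≢0 ua ub uc ux uy uz = odd (unit-* ua ux) (unit-* ub uy) (unit-* uc uz)
    where
    odd : ∀ {s t u} → IsUnit s → IsUnit t → IsUnit u → s + t + u ≢ 0ℤ
    odd (inj₁ refl) (inj₁ refl) (inj₁ refl) ()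
    odd (inj₁ refl) (inj₁ refl) (inj₂ refl) ()
    odd (inj₁ refl) (inj₂ refl) (inj₁ refl) ()
    odd (inj₁ refl) (inj₂ refl) (inj₂ refl) ()
    odd (inj₂ refl) (inj₁ refl) (inj₁ refl) ()
    odd (inj₂ refl) (inj₁ refl) (inj₂ refl) ()
    odd (inj₂ refl) (inj₂ refl) (inj₁ refl) ()
    odd (inj₂ refl) (inj₂ refl) (inj₂ refl) ()

  combo-lonely₁ : ∀ {a} b c x → IsUnit a → IsUnit x → combo a b c x 0ℤ 0ℤ ≢ 0ℤ
  combo-lonely₁ {a} b c x ua ux eq = unit≢0 (unit-* ua ux) (trans (sym (drop a b c x)) eq)
    where
    drop : ∀ a b c x → a * x + b * 0ℤ + c * 0ℤ ≡ a * x
    drop = solve-∀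

  combo-lonely₂ : ∀ a {b} c y → IsUnit b → IsUnit y → combo a b c 0ℤ y 0ℤ ≢ 0ℤ
  combo-lonely₂ a {b} c y ub uy eq = unit≢0 (unit-* ub uy) (trans (sym (drop a b c y)) eq)
    where
    drop : ∀ a b c y → a * 0ℤ + b * y + c * 0ℤ ≡ b * y
    drop = solve-∀

  combo-lonely₃ : ∀ a b {c} z → IsUnit c → IsUnit z → combo a b c 0ℤ 0ℤ z ≢ 0ℤ
  combo-lonely₃ a b {c} z uc uz eq = unit≢0 (unit-* uc uz) (trans (sym (drop a b c z)) eq)
    where
    drop : ∀ a b c z → a * 0ℤ + b * 0ℤ + c * z ≡ c * z
    drop = solve-∀

  combo-cong : ∀ a b c {x y z x′ y′ z′} → x ≡ x′ → y ≡ y′ → z ≡ z′ →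
               combo a b c x y z ≡ combo a b c x′ y′ z′
  combo-cong a b c refl refl refl = refl

  combo-swap₁₂ : ∀ a b c x y z → a * x + b * y + c * z ≡ b * y + a * x + c * z
  combo-swap₁₂ = solve-∀
  combo-swap₁₃ : ∀ a b c x y z → a * x + b * y + c * z ≡ c * z + b * y + a * x
  combo-swap₁₃ = solve-∀
  combo-swap₂₃ : ∀ a b c x y z → a * x + b * y + c * z ≡ a * x + c * z + b * y
  combo-swap₂₃ = solve-∀

module VectorAlgebra where
  open import Data.Nat using (zero; suc)
  open import Data.Integer using (ℤ; 0ℤ; 1ℤ; -1ℤ; _*_; _+_; -_)
  import Data.Integer.Properties as ℤP
  open import Data.Integer.Tactic.RingSolver using (solve-∀)
  open import Data.Fin using (Fin)
  open import Data.Vec using (_∷_; []; lookup)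
  import Data.Vec.Properties as VP
  open import Relation.Binary.PropositionalEquality

  lookup-⊕ : ∀ {d} (r : Fin d) (u v : ℤ^ d) → lookup (u ⊕ v) r ≡ lookup u r + lookup v r
  lookup-⊕ r u v = VP.lookup-zipWith _+_ r u v

  lookup-· : ∀ {d} (r : Fin d) k (u : ℤ^ d) → lookup (k · u) r ≡ k * lookup u r
  lookup-· r k u = VP.lookup-map r (k *_) u

  lookup-0v : ∀ {d} (r : Fin d) → lookup (0v {d}) r ≡ 0ℤ
  lookup-0v r = VP.lookup-replicate r 0ℤ

  ⊕-identityʳ : ∀ {d} (u : ℤ^ d) → u ⊕ 0v ≡ u
  ⊕-identityʳ []      = refl
  ⊕-identityʳ (x ∷ u) = cong₂ _∷_ (ℤP.+-identityʳ x) (⊕-identityʳ u)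

  ⊕-identityˡ : ∀ {d} (u : ℤ^ d) → 0v ⊕ u ≡ u
  ⊕-identityˡ []      = refl
  ⊕-identityˡ (x ∷ u) = cong₂ _∷_ (ℤP.+-identityˡ x) (⊕-identityˡ u)

  ⊕-interchange : ∀ {d} (a b c e : ℤ^ d) → (a ⊕ b) ⊕ (c ⊕ e) ≡ (a ⊕ c) ⊕ (b ⊕ e)
  ⊕-interchange []      []      []      []      = refl
  ⊕-interchange (x ∷ a) (y ∷ b) (z ∷ c) (t ∷ e) = cong₂ _∷_ (interchange x y z t) (⊕-interchange a b c e)
    where
    interchange : ∀ x y z t → (x + y) + (z + t) ≡ (x + z) + (y + t)
    interchange = solve-∀

  ·-distrib-⊕ : ∀ {d} k (u v : ℤ^ d) → k · (u ⊕ v) ≡ k · u ⊕ k · v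
  ·-distrib-⊕ k []      []      = refl
  ·-distrib-⊕ k (x ∷ u) (y ∷ v) = cong₂ _∷_ (ℤP.*-distribˡ-+ k x y) (·-distrib-⊕ k u v)

  +-distrib-· : ∀ {d} a b (u : ℤ^ d) → (a + b) · u ≡ a · u ⊕ b · u
  +-distrib-· a b []      = refl
  +-distrib-· a b (x ∷ u) = cong₂ _∷_ (ℤP.*-distribʳ-+ x a b) (+-distrib-· a b u)

  *-assoc-· : ∀ {d} a b (u : ℤ^ d) → (a * b) · u ≡ a · (b · u)
  *-assoc-· a b []      = refl
  *-assoc-· a b (x ∷ u) = cong₂ _∷_ (ℤP.*-assoc a b x) (*-assoc-· a b u)

  0-· : ∀ {d} (u : ℤ^ d) → 0ℤ · u ≡ 0v
  0-· []      = refl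
  0-· (x ∷ u) = cong (0ℤ ∷_) (0-· u)

  1-· : ∀ {d} (u : ℤ^ d) → 1ℤ · u ≡ u
  1-· []      = refl
  1-· (x ∷ u) = cong₂ _∷_ (ℤP.*-identityˡ x) (1-· u)

  ·-0v : ∀ {d} k → k · 0v {d} ≡ 0v
  ·-0v {zero}  k = refl
  ·-0v {suc d} k = cong₂ _∷_ (ℤP.*-zeroʳ k) (·-0v k)

  ⊕-0· : ∀ {d} (u w : ℤ^ d) → u ⊕ 0ℤ · w ≡ u
  ⊕-0· u w = trans (cong (u ⊕_) (0-· w)) (⊕-identityʳ u)

  neg≡-1· : ∀ {d} (u : ℤ^ d) → neg u ≡ -1ℤ · u
  neg≡-1· []      = refl
  neg≡-1· (x ∷ u) = cong₂ _∷_ (sym (ℤP.-1*i≡-i x)) (neg≡-1· u)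

  neg-involutive : ∀ {d} (u : ℤ^ d) → neg (neg u) ≡ u
  neg-involutive []      = refl
  neg-involutive (x ∷ u) = cong₂ _∷_ (ℤP.neg-involutive x) (neg-involutive u)

  neg-·-comm : ∀ {d} k (u : ℤ^ d) → neg (k · u) ≡ k · neg u
  neg-·-comm k []      = refl
  neg-·-comm k (x ∷ u) = cong₂ _∷_ (ℤP.neg-distribʳ-* k x) (neg-·-comm k u)

  neg-shear : ∀ {d} (u w : ℤ^ d) s → neg (u ⊕ s · w) ≡ neg u ⊕ (- s) · w
  neg-shear []      []      s = refl
  neg-shear (x ∷ u) (y ∷ w) s = cong₂ _∷_ (identity x s y) (neg-shear u w s)
    where
    identity : ∀ x s y → - (x + s * y) ≡ - x + (- s) * y
    identity = solve-∀

  shear-cancel : ∀ {d} (u w : ℤ^ d) s → (u ⊕ s · w) ⊕ (- s) · w ≡ u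
  shear-cancel []      []      s = refl
  shear-cancel (x ∷ u) (y ∷ w) s = cong₂ _∷_ (identity x s y) (shear-cancel u w s)
    where
    identity : ∀ x s y → (x + s * y) + (- s) * y ≡ x
    identity = solve-∀

  u⊕-1·u≡0 : ∀ {d} (u : ℤ^ d) → u ⊕ -1ℤ · u ≡ 0v
  u⊕-1·u≡0 []      = refl
  u⊕-1·u≡0 (x ∷ u) = cong₂ _∷_ (identity x) (u⊕-1·u≡0 u)
    where
    identity : ∀ x → x + -1ℤ * x ≡ 0ℤ
    identity = solve-∀

  ⊕≡0⇒≡-1· : ∀ {d} (u v : ℤ^ d) → u ⊕ v ≡ 0v → u ≡ -1ℤ · v
  ⊕≡0⇒≡-1· []      []      eq = refl
  ⊕≡0⇒≡-1· (x ∷ u) (y ∷ v) eq =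
    cong₂ _∷_ (solve-ℤ x y (VP.∷-injectiveˡ eq)) (⊕≡0⇒≡-1· u v (VP.∷-injectiveʳ eq))
    where
    identity : ∀ x y → x ≡ (x + y) + -1ℤ * y
    identity = solve-∀
    solve-ℤ : ∀ x y → x + y ≡ 0ℤ → x ≡ -1ℤ * y
    solve-ℤ x y x+y≡0 = trans (identity x y) (trans (cong (_+ -1ℤ * y) x+y≡0) (ℤP.+-identityˡ _))

  ⊕-1·≡0⇒≡ : ∀ {d} (u v : ℤ^ d) → u ⊕ -1ℤ · v ≡ 0v → u ≡ v
  ⊕-1·≡0⇒≡ u v eq = begin
    u                         ≡⟨ sym (shear-cancel u v -1ℤ) ⟩
    (u ⊕ -1ℤ · v) ⊕ 1ℤ · v    ≡⟨ cong₂ _⊕_ eq (1-· v) ⟩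
    0v ⊕ v                    ≡⟨ ⊕-identityˡ v ⟩
    v                         ∎
    where open ≡-Reasoning

module LinearCombinations where
  open import Data.Nat using (zero; suc)
  open import Data.Integer using (ℤ; 0ℤ; 1ℤ; -1ℤ)
  open import Data.Fin as Fin using (Fin; zero; suc)
  open import Data.Vec using (Vec; _∷_; []; lookup; tabulate)
  import Data.Vec.Properties as VP
  open import Data.Product using (proj₂)
  open import Relation.Binary.PropositionalEquality
  open import Relation.Nullary using (does)
  open import Data.Bool using (if_then_else_)
  open import Relation.Nullary.Decidable using (dec-true; dec-false)
  open VectorAlgebra

  std-same : ∀ {d} (k : Fin d) → lookup (std k) k ≡ 1ℤ
  std-same k rewrite VP.lookup∘tabulate (λ j → if does (j Fin.≟ k) then 1ℤ else 0ℤ) k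
                   | dec-true (k Fin.≟ k) refl = refl

  std-diff : ∀ {d} {r k : Fin d} → r ≢ k → lookup (std k) r ≡ 0ℤ
  std-diff {r = r} {k} r≢k rewrite VP.lookup∘tabulate (λ j → if does (j Fin.≟ k) then 1ℤ else 0ℤ) r
                                 | dec-false (r Fin.≟ k) r≢k = refl

  lincomb-⊕ : ∀ {d p} (bs : Vec (ℤ^ d) p) c e → lincomb bs (c ⊕ e) ≡ lincomb bs c ⊕ lincomb bs e
  lincomb-⊕ []       []       []       = sym (⊕-identityʳ 0v)
  lincomb-⊕ (b ∷ bs) (c ∷ cs) (e ∷ es) =
    trans (cong₂ _⊕_ (+-distrib-· c e b) (lincomb-⊕ bs cs es))
          (⊕-interchange (c · b) (e · b) (lincomb bs cs) (lincomb bs es))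

  lincomb-· : ∀ {d p} (bs : Vec (ℤ^ d) p) k c → lincomb bs (k · c) ≡ k · lincomb bs c
  lincomb-· []       k []       = sym (·-0v k)
  lincomb-· (b ∷ bs) k (c ∷ cs) =
    trans (cong₂ _⊕_ (*-assoc-· k c b) (lincomb-· bs k cs)) (sym (·-distrib-⊕ k (c · b) (lincomb bs cs)))

  lincomb-0v : ∀ {d p} (bs : Vec (ℤ^ d) p) → lincomb bs 0v ≡ 0v
  lincomb-0v []       = refl
  lincomb-0v (b ∷ bs) = trans (cong₂ _⊕_ (0-· b) (lincomb-0v bs)) (⊕-identityʳ 0v)

  lincomb-std : ∀ {d p} (bs : Vec (ℤ^ d) p) k → lincomb bs (std k) ≡ lookup bs k
  lincomb-std {p = suc p} (b ∷ bs) zero =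
    trans (cong₂ _⊕_ (1-· b) (trans (cong (lincomb bs) (zeros p)) (lincomb-0v bs))) (⊕-identityʳ b)
    where
    zeros : ∀ p → tabulate {n = p} (λ _ → 0ℤ) ≡ 0v
    zeros zero    = refl
    zeros (suc p) = cong (0ℤ ∷_) (zeros p)
  lincomb-std (b ∷ bs) (suc k) = trans (cong₂ _⊕_ (0-· b) (lincomb-std bs k)) (⊕-identityˡ _)

  lincomb-injective : ∀ {d p} (bs : Vec (ℤ^ d) p) → IsBasis bs →
                      ∀ c e → lincomb bs c ≡ lincomb bs e → c ≡ e
  lincomb-injective bs B c e eq = ⊕-1·≡0⇒≡ c e (proj₂ B _ (begin
    lincomb bs (c ⊕ -1ℤ · e)              ≡⟨ lincomb-⊕ bs c (-1ℤ · e) ⟩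
    lincomb bs c ⊕ lincomb bs (-1ℤ · e)   ≡⟨ cong₂ _⊕_ eq (lincomb-· bs -1ℤ e) ⟩
    lincomb bs e ⊕ -1ℤ · lincomb bs e     ≡⟨ u⊕-1·u≡0 _ ⟩
    0v                                    ∎))
    where open ≡-Reasoning

module Lines where
  open import Data.Integer as ℤ using ()
  open import Data.Fin using (Fin; zero; suc)
  open import Data.Vec using (Vec; _∷_; lookup; toList)
  import Data.Vec.Properties as VP
  open import Data.List using (List; []; _∷_; _++_)
  open import Data.List.Membership.Propositional using (_∈_)
  open import Data.List.Membership.Propositional.Properties using (∈-++⁺ˡ; ∈-++⁺ʳ; ∈-++⁻)
  open import Data.List.Relation.Unary.Any using (here; there)
  open import Data.Product using (∃-syntax; _,_)
  open import Data.Sum using (_⊎_; inj₁; inj₂)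
  open import Relation.Binary.PropositionalEquality
  open import Relation.Nullary using (Dec; yes; no)
  open VectorAlgebra

  sameLine-sym : ∀ {d} {u v : ℤ^ d} → SameLine u v → SameLine v u
  sameLine-sym (inj₁ refl) = inj₁ refl
  sameLine-sym (inj₂ refl) = inj₂ (sym (neg-involutive _))

  sameLine-trans : ∀ {d} {u v x : ℤ^ d} → SameLine u v → SameLine v x → SameLine u x
  sameLine-trans (inj₁ refl) s           = s
  sameLine-trans (inj₂ refl) (inj₁ refl) = inj₂ refl
  sameLine-trans (inj₂ refl) (inj₂ refl) = inj₁ (neg-involutive _)

  sameLine-dec : ∀ {d} (u v : ℤ^ d) → Dec (SameLine u v)
  sameLine-dec u v with VP.≡-dec ℤ._≟_ u v | VP.≡-dec ℤ._≟_ u (neg v)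
  ... | yes u≡v | _         = yes (inj₁ u≡v)
  ... | no _    | yes u≡-v  = yes (inj₂ u≡-v)
  ... | no u≢v  | no u≢-v   = no λ { (inj₁ e) → u≢v e ; (inj₂ e) → u≢-v e }

  ∈ₗ-sameLine : ∀ {d} {L : List (ℤ^ d)} {v x} → v ∈ₗ L → SameLine v x → x ∈ₗ L
  ∈ₗ-sameLine (u , u∈L , s) s′ = u , u∈L , sameLine-trans s s′

  ∈⇒∈ₗ : ∀ {d} {L : List (ℤ^ d)} {v} → v ∈ L → v ∈ₗ L
  ∈⇒∈ₗ v∈L = _ , v∈L , inj₁ refl

  ∈ₗ-++⁻ : ∀ {d} (L : List (ℤ^ d)) {K v} → v ∈ₗ (L ++ K) → v ∈ₗ L ⊎ v ∈ₗ K
  ∈ₗ-++⁻ L (u , u∈ , s) with ∈-++⁻ L u∈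
  ... | inj₁ u∈L = inj₁ (u , u∈L , s)
  ... | inj₂ u∈K = inj₂ (u , u∈K , s)

  ∈ₗ-++⁺ˡ : ∀ {d} {L K : List (ℤ^ d)} {v} → v ∈ₗ L → v ∈ₗ (L ++ K)
  ∈ₗ-++⁺ˡ (u , u∈L , s) = u , ∈-++⁺ˡ u∈L , s

  ∈ₗ-++⁺ʳ : ∀ {d} (L : List (ℤ^ d)) {K v} → v ∈ₗ K → v ∈ₗ (L ++ K)
  ∈ₗ-++⁺ʳ L (u , u∈K , s) = u , ∈-++⁺ʳ L u∈K , s

  ∈ₗ-dec : ∀ {d} (v : ℤ^ d) L → Dec (v ∈ₗ L)
  ∈ₗ-dec v [] = no λ { (_ , () , _) }
  ∈ₗ-dec v (u ∷ L) with sameLine-dec u v | ∈ₗ-dec v L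
  ... | yes s | _                  = yes (u , here refl , s)
  ... | no _  | yes (u′ , u′∈ , s) = yes (u′ , there u′∈ , s)
  ... | no ¬s | no ¬∈              =
    no λ { (_ , here refl , s) → ¬s s ; (u′ , there u′∈ , s) → ¬∈ (u′ , u′∈ , s) }

  lookup∈toList : ∀ {A : Set} {p} (v : Vec A p) k → lookup v k ∈ toList v
  lookup∈toList (x ∷ v) zero    = here refl
  lookup∈toList (x ∷ v) (suc k) = there (lookup∈toList v k)

  ∈toList⇒lookup : ∀ {A : Set} {p} (v : Vec A p) {x} → x ∈ toList v → ∃[ k ] x ≡ lookup v k
  ∈toList⇒lookup (y ∷ v) (here refl) = zero , refl
  ∈toList⇒lookup (y ∷ v) (there x∈) with ∈toList⇒lookup v x∈
  ... | k , e = suc k , e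

module Coordinates where
  open import Data.Integer using (ℤ; 0ℤ; 1ℤ; -1ℤ; _*_; _+_)
  import Data.Integer.Properties as ℤP
  open import Data.Fin using (Fin; zero; suc)
  open import Data.Vec using (Vec; _∷_; []; lookup)
  open import Data.Product using (proj₁; proj₂)
  open import Data.Sum using (inj₁; inj₂)
  open import Function using (_∘_)
  open import Relation.Binary.PropositionalEquality
  open IntegerUnits
  open VectorAlgebra
  open LinearCombinations

  relation-lookup : ∀ {q} (a b c : ℤ) (X Y Z : ℤ^ q) → a · X ⊕ b · Y ⊕ c · Z ≡ 0v →
                    ∀ r → combo a b c (lookup X r) (lookup Y r) (lookup Z r) ≡ 0ℤ
  relation-lookup a b c X Y Z eq r = begin
    a * lookup X r + b * lookup Y r + c * lookup Z r
      ≡⟨ sym (cong₂ _+_ (trans (lookup-⊕ r (a · X) (b · Y)) (cong₂ _+_ (lookup-· r a X) (lookup-· r b Y)))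
                        (lookup-· r c Z)) ⟩
    lookup (a · X ⊕ b · Y) r + lookup (c · Z) r  ≡⟨ sym (lookup-⊕ r (a · X ⊕ b · Y) (c · Z)) ⟩
    lookup (a · X ⊕ b · Y ⊕ c · Z) r             ≡⟨ cong (λ v → lookup v r) eq ⟩
    lookup 0v r                                  ≡⟨ lookup-0v r ⟩
    0ℤ                                           ∎
    where open ≡-Reasoning

  module _ {d p} (bs : Vec (ℤ^ d) p) (B : IsBasis bs) where

    coord : ℤ^ d → ℤ^ p
    coord x = proj₁ (proj₁ B x)

    coord-spec : ∀ x → lincomb bs (coord x) ≡ x
    coord-spec x = proj₂ (proj₁ B x)

    coord-unique : ∀ {x} c → lincomb bs c ≡ x → coord x ≡ c
    coord-unique {x} c eq = lincomb-injective bs B _ _ (trans (coord-spec x) (sym eq))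

    coord-⊕ : ∀ x y → coord (x ⊕ y) ≡ coord x ⊕ coord y
    coord-⊕ x y = coord-unique _ (trans (lincomb-⊕ bs (coord x) (coord y)) (cong₂ _⊕_ (coord-spec x) (coord-spec y)))

    coord-· : ∀ k x → coord (k · x) ≡ k · coord x
    coord-· k x = coord-unique _ (trans (lincomb-· bs k (coord x)) (cong (k ·_) (coord-spec x)))

    coord-0v : coord 0v ≡ 0v
    coord-0v = coord-unique _ (lincomb-0v bs)

    coord-basis : ∀ k → coord (lookup bs k) ≡ std k
    coord-basis k = coord-unique _ (lincomb-std bs k)

    coord-neg : ∀ x → coord (neg x) ≡ -1ℤ · coord x
    coord-neg x = trans (cong coord (neg≡-1· x)) (coord-· -1ℤ x)

    coord-relation : ∀ {s₀ s₁ s₂ x y z} → s₀ · x ⊕ s₁ · y ⊕ s₂ · z ≡ 0v →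
                     s₀ · coord x ⊕ s₁ · coord y ⊕ s₂ · coord z ≡ 0v
    coord-relation {s₀} {s₁} {s₂} {x} {y} {z} eq = begin
      s₀ · coord x ⊕ s₁ · coord y ⊕ s₂ · coord z
        ≡⟨ sym (cong₂ _⊕_ (trans (coord-⊕ (s₀ · x) (s₁ · y)) (cong₂ _⊕_ (coord-· s₀ x) (coord-· s₁ y)))
                          (coord-· s₂ z)) ⟩
      coord (s₀ · x ⊕ s₁ · y) ⊕ coord (s₂ · z)   ≡⟨ sym (coord-⊕ _ _) ⟩
      coord (s₀ · x ⊕ s₁ · y ⊕ s₂ · z)           ≡⟨ cong coord eq ⟩
      coord 0v                                   ≡⟨ coord-0v ⟩
      0v                                         ∎
      where open ≡-Reasoning

    Vanishes : Fin p → ℤ^ d → Set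
    Vanishes k x = lookup (coord x) k ≡ 0ℤ

    vanishes-⊕ : ∀ {k x y} → Vanishes k x → Vanishes k y → Vanishes k (x ⊕ y)
    vanishes-⊕ {k} {x} {y} zx zy =
      trans (cong (λ v → lookup v k) (coord-⊕ x y)) (trans (lookup-⊕ k (coord x) (coord y)) (cong₂ _+_ zx zy))

    vanishes-· : ∀ {k x} c → Vanishes k x → Vanishes k (c · x)
    vanishes-· {k} {x} c zx = trans (cong (λ v → lookup v k) (coord-· c x))
      (trans (lookup-· k c (coord x)) (trans (cong (c *_) zx) (ℤP.*-zeroʳ c)))

    vanishes-0v : ∀ {k} → Vanishes k 0v
    vanishes-0v {k} = trans (cong (λ v → lookup v k) coord-0v) (lookup-0v k)

    vanishes-sameLine : ∀ {k x y} → SameLine x y → Vanishes k x → Vanishes k y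
    vanishes-sameLine (inj₁ refl) zx = zx
    vanishes-sameLine {k} {y = y} (inj₂ refl) zx =
      subst (Vanishes k) (trans (sym (neg≡-1· (neg y))) (neg-involutive y)) (vanishes-· -1ℤ zx)

    vanishes-lincomb : ∀ {k q} (vs : Vec (ℤ^ d) q) → (∀ l → Vanishes k (lookup vs l)) →
                       ∀ c → Vanishes k (lincomb vs c)
    vanishes-lincomb []       h []       = vanishes-0v
    vanishes-lincomb (v ∷ vs) h (c ∷ cs) = vanishes-⊕ (vanishes-· c (h zero)) (vanishes-lincomb vs (h ∘ suc) cs)

  -- bₖ = z·u forces z·uₖ = 1 for the k-th coordinate uₖ of u, so z is a unit
  basis-primitive : ∀ {d p} (bs : Vec (ℤ^ d) p) → IsBasis bs → ∀ k → IsPrimitive (lookup bs k)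
  basis-primitive bs B k z u eq = *≡1⇒unit z (lookup (coord bs B u) k) (sym (begin
    1ℤ                                  ≡⟨ sym (std-same k) ⟩
    lookup (std k) k                    ≡⟨ cong (λ v → lookup v k) (sym (coord-basis bs B k)) ⟩
    lookup (coord bs B (lookup bs k)) k ≡⟨ cong (λ v → lookup (coord bs B v) k) eq ⟩
    lookup (coord bs B (z · u)) k       ≡⟨ cong (λ v → lookup v k) (coord-· bs B z u) ⟩
    lookup (z · coord bs B u) k         ≡⟨ lookup-· k z (coord bs B u) ⟩
    z * lookup (coord bs B u) k         ∎))
    where open ≡-Reasoning

  primitive-sameLine : ∀ {d} {v w : ℤ^ d} → SameLine v w → IsPrimitive v → IsPrimitive w
  primitive-sameLine (inj₁ refl) pv = pv
  primitive-sameLine (inj₂ refl) pv k u eq = pv k (neg u) (trans (cong neg eq) (neg-·-comm k u))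

-- If w = Σ aₖ bₖ and γ is a vector of
-- shears whose support is disjoint from that of a, then the vectors
-- bₖ + γₖ·w again form a basis: the shear is undone by subtracting the
-- multiple ⟨c,γ⟩ of w, which does not disturb w itself.
module ShearedBasis where
  open import Data.Integer using (ℤ; 0ℤ; -1ℤ; _*_; _+_; -_)
  import Data.Integer.Properties as ℤP
  open import Data.Fin using (Fin; zero; suc)
  open import Data.Vec using (Vec; _∷_; []; lookup; zipWith)
  import Data.Vec.Properties as VP
  open import Data.Product using (∃-syntax; _,_; proj₁; proj₂)
  open import Data.Sum using (_⊎_; inj₁; inj₂)
  open import Function using (_∘_)
  open import Relation.Binary.PropositionalEquality
  open VectorAlgebra
  open LinearCombinations

  dot : ∀ {p} → Vec ℤ p → Vec ℤ p → ℤ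
  dot []      []      = 0ℤ
  dot (x ∷ c) (y ∷ e) = x * y + dot c e

  dot-· : ∀ {p} k (c e : Vec ℤ p) → dot (k · c) e ≡ k * dot c e
  dot-· k []      []      = sym (ℤP.*-zeroʳ k)
  dot-· k (x ∷ c) (y ∷ e) =
    trans (cong₂ _+_ (ℤP.*-assoc k x y) (dot-· k c e)) (sym (ℤP.*-distribˡ-+ k (x * y) (dot c e)))

  DisjointSupport : ∀ {p} → Vec ℤ p → Vec ℤ p → Set
  DisjointSupport a γ = ∀ k → lookup γ k ≡ 0ℤ ⊎ lookup a k ≡ 0ℤ

  dot-disjoint : ∀ {p} (a γ : Vec ℤ p) → DisjointSupport a γ → dot a γ ≡ 0ℤ
  dot-disjoint []      []      h = refl
  dot-disjoint (x ∷ a) (y ∷ γ) h = trans (cong₂ _+_ (product≡0 (h zero)) (dot-disjoint a γ (h ∘ suc))) refl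
    where
    product≡0 : y ≡ 0ℤ ⊎ x ≡ 0ℤ → x * y ≡ 0ℤ
    product≡0 (inj₁ refl) = ℤP.*-zeroʳ x
    product≡0 (inj₂ refl) = refl

  shear : ∀ {d} → ℤ^ d → ℤ^ d → ℤ → ℤ^ d
  shear w u g = u ⊕ g · w

  lincomb-shear : ∀ {d q} (w : ℤ^ d) (bs : Vec (ℤ^ d) q) γ c →
                  lincomb (zipWith (shear w) bs γ) c ≡ lincomb bs c ⊕ dot c γ · w
  lincomb-shear w []       []       [] = sym (trans (cong (0v ⊕_) (0-· w)) (⊕-identityʳ 0v))
  lincomb-shear w (u ∷ bs) (g ∷ γ) (c ∷ cs) = begin
    c · (u ⊕ g · w) ⊕ lincomb (zipWith (shear w) bs γ) cs
      ≡⟨ cong₂ _⊕_ (trans (·-distrib-⊕ c u (g · w)) (cong (c · u ⊕_) (sym (*-assoc-· c g w))))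
                   (lincomb-shear w bs γ cs) ⟩
    (c · u ⊕ (c * g) · w) ⊕ (lincomb bs cs ⊕ dot cs γ · w)
      ≡⟨ ⊕-interchange (c · u) ((c * g) · w) (lincomb bs cs) (dot cs γ · w) ⟩
    (c · u ⊕ lincomb bs cs) ⊕ ((c * g) · w ⊕ dot cs γ · w)
      ≡⟨ cong ((c · u ⊕ lincomb bs cs) ⊕_) (sym (+-distrib-· (c * g) (dot cs γ) w)) ⟩
    (c · u ⊕ lincomb bs cs) ⊕ (c * g + dot cs γ) · w ∎
    where open ≡-Reasoning

  module Shearing {d p} (bs : Vec (ℤ^ d) p) (B : IsBasis bs) (w : ℤ^ d) (a γ : Vec ℤ p)
           (w≡Σab : lincomb bs a ≡ w) (disjoint : DisjointSupport a γ) where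

    sheared : Vec (ℤ^ d) p
    sheared = zipWith (shear w) bs γ

    lookup-sheared : ∀ k → lookup sheared k ≡ lookup bs k ⊕ lookup γ k · w
    lookup-sheared k = VP.lookup-zipWith (shear w) k bs γ

    w≡Σa·sheared : lincomb sheared a ≡ w
    w≡Σa·sheared = begin
      lincomb sheared a            ≡⟨ lincomb-shear w bs γ a ⟩
      lincomb bs a ⊕ dot a γ · w   ≡⟨ cong₂ _⊕_ w≡Σab (cong (_· w) (dot-disjoint a γ disjoint)) ⟩
      w ⊕ 0ℤ · w                   ≡⟨ ⊕-0· w w ⟩
      w                            ∎
      where open ≡-Reasoning

    sheared-spans : ∀ x → ∃[ c ] lincomb sheared c ≡ x
    sheared-spans x = c ⊕ (- s) · a , (begin
      lincomb sheared (c ⊕ (- s) · a)               ≡⟨ lincomb-⊕ sheared c ((- s) · a) ⟩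
      lincomb sheared c ⊕ lincomb sheared ((- s) · a)
        ≡⟨ cong₂ _⊕_ (lincomb-shear w bs γ c) (trans (lincomb-· sheared (- s) a) (cong ((- s) ·_) w≡Σa·sheared)) ⟩
      (lincomb bs c ⊕ s · w) ⊕ (- s) · w            ≡⟨ shear-cancel (lincomb bs c) w s ⟩
      lincomb bs c                                  ≡⟨ proj₂ (proj₁ B x) ⟩
      x                                             ∎)
      where
      open ≡-Reasoning
      c = proj₁ (proj₁ B x)
      s = dot c γ

    -- a relation Σ cₖ (bₖ + γₖ w) = 0 is a relation Σ (c + ⟨c,γ⟩ a)ₖ bₖ = 0,
    -- so c = -⟨c,γ⟩ a; then ⟨c,γ⟩ = -⟨c,γ⟩⟨a,γ⟩ = 0 and hence c = 0
    sheared-independent : ∀ c → lincomb sheared c ≡ 0v → c ≡ 0v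
    sheared-independent c eq = begin
      c                    ≡⟨ c≡-s·a ⟩
      -1ℤ · (s · a)        ≡⟨ cong (λ t → -1ℤ · (t · a)) s≡0 ⟩
      -1ℤ · (0ℤ · a)       ≡⟨ cong (-1ℤ ·_) (0-· a) ⟩
      -1ℤ · 0v             ≡⟨ ·-0v -1ℤ ⟩
      0v                   ∎
      where
      open ≡-Reasoning
      s = dot c γ
      relation : lincomb bs (c ⊕ s · a) ≡ 0v
      relation = begin
        lincomb bs (c ⊕ s · a)              ≡⟨ lincomb-⊕ bs c (s · a) ⟩
        lincomb bs c ⊕ lincomb bs (s · a)   ≡⟨ cong (lincomb bs c ⊕_) (trans (lincomb-· bs s a) (cong (s ·_) w≡Σab)) ⟩
        lincomb bs c ⊕ s · w                ≡⟨ sym (lincomb-shear w bs γ c) ⟩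
        lincomb sheared c                   ≡⟨ eq ⟩
        0v                                  ∎
      c≡-s·a : c ≡ -1ℤ · (s · a)
      c≡-s·a = ⊕≡0⇒≡-1· c (s · a) (proj₂ B _ relation)
      s≡0 : s ≡ 0ℤ
      s≡0 = begin
        dot c γ                    ≡⟨ cong (λ v → dot v γ) c≡-s·a ⟩
        dot (-1ℤ · (s · a)) γ      ≡⟨ dot-· -1ℤ (s · a) γ ⟩
        -1ℤ * dot (s · a) γ        ≡⟨ cong (-1ℤ *_) (dot-· s a γ) ⟩
        -1ℤ * (s * dot a γ)        ≡⟨ cong (λ t → -1ℤ * (s * t)) (dot-disjoint a γ disjoint) ⟩
        -1ℤ * (s * 0ℤ)             ≡⟨ cong (-1ℤ *_) (ℤP.*-zeroʳ s) ⟩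
        0ℤ                         ∎

    sheared-basis : IsBasis sheared
    sheared-basis = sheared-spans , sheared-independent

-- The symmetric quotient by N = suc N′: the integer q(z) with
-- |z + q(z)·N| < N obtained by truncating z/N towards zero.  It is odd and
-- vanishes on the strip |z| < N.
module SymmetricQuotient where
  open import Data.Nat as ℕ using (ℕ; zero; suc)
  open import Data.Nat.DivMod using (_/_; _%_; m≡m%n+[m/n]*n; m%n<n; m<n⇒m/n≡0)
  open import Data.Integer using (ℤ; +_; -[1+_]; +[1+_]; 0ℤ; _*_; _+_; -_; ∣_∣)
  import Data.Integer.Properties as ℤP
  open import Data.Integer.Tactic.RingSolver using (solve-∀)
  open import Relation.Binary.PropositionalEquality

  quot : ℕ → ℤ → ℤ
  quot N′ (+ n)    = - (+ (n / suc N′))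
  quot N′ -[1+ n ] = + (suc n / suc N′)

  quot-odd : ∀ N′ z → quot N′ (- z) ≡ - quot N′ z
  quot-odd N′ (+ zero)  = refl
  quot-odd N′ +[1+ n ]  = sym (ℤP.neg-involutive _)
  quot-odd N′ -[1+ n ]  = refl

  divmod-ℤ : ∀ N′ n → + n ≡ + (n % suc N′) + + (n / suc N′) * + suc N′
  divmod-ℤ N′ n = trans (cong +_ (m≡m%n+[m/n]*n n (suc N′)))
    (trans (ℤP.pos-+ (n % suc N′) _) (cong (λ e → + (n % suc N′) + e) (ℤP.pos-* (n / suc N′) (suc N′))))

  quot-remainder : ∀ N′ z → ∣ z + quot N′ z * + suc N′ ∣ ℕ.< suc N′
  quot-remainder N′ (+ n) = subst (λ e → ∣ e ∣ ℕ.< suc N′) (sym remainder) (m%n<n n (suc N′))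
    where
    cancel : ∀ r q N → (r + q * N) + (- q) * N ≡ r
    cancel = solve-∀
    remainder : + n + quot N′ (+ n) * + suc N′ ≡ + (n % suc N′)
    remainder = trans (cong (_+ quot N′ (+ n) * + suc N′) (divmod-ℤ N′ n)) (cancel (+ (n % suc N′)) (+ (n / suc N′)) (+ suc N′))
  quot-remainder N′ -[1+ n ] = subst (λ e → ∣ e ∣ ℕ.< suc N′) (sym remainder)
      (subst (ℕ._< suc N′) (sym (ℤP.∣-i∣≡∣i∣ (+ (suc n % suc N′)))) (m%n<n (suc n) (suc N′)))
    where
    cancel : ∀ r q N → - (r + q * N) + q * N ≡ - r
    cancel = solve-∀
    remainder : -[1+ n ] + quot N′ -[1+ n ] * + suc N′ ≡ - (+ (suc n % suc N′))
    remainder = trans (cong (λ e → - e + quot N′ -[1+ n ] * + suc N′) (divmod-ℤ N′ (suc n)))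
                  (cancel (+ (suc n % suc N′)) (+ (suc n / suc N′)) (+ suc N′))

  quot-strip : ∀ N′ z → ∣ z ∣ ℕ.< suc N′ → quot N′ z ≡ 0ℤ
  quot-strip N′ (+ n)    lt = cong (λ e → - (+ e)) (m<n⇒m/n≡0 lt)
  quot-strip N′ -[1+ n ] lt = cong +_ (m<n⇒m/n≡0 lt)

open import Data.Fin using (Fin)
open import Data.Vec using (Vec; lookup)
open import Relation.Binary.PropositionalEquality using (_≡_; _≢_)

-- Relation rigidity in an augmented frame {v₀, b₁,…,b_p} with
-- ±v₀ ± bᵢ ± bⱼ = 0, i ≠ j.  In the coordinates of the basis b, the lines of
-- the frame are e₁,…,e_p and v₀ = (unit at i, unit at j, zero elsewhere).
-- A coordinatewise relation between three of them with unit coefficients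
-- forces them to be exactly ⟨v₀⟩, ⟨bᵢ⟩, ⟨bⱼ⟩: at any coordinate, one unit
-- term cannot cancel alone, nor can three.
module FrameRelations {d p} (vs : Vec (ℤ^ d) p) (B : IsBasis vs) (v₀ : ℤ^ d) (i j : Fin p) (i≢j : i ≢ j)
                      (rel : SignedSumZero v₀ (lookup vs i) (lookup vs j)) where
  open import Data.Integer using (ℤ; 0ℤ; 1ℤ; -1ℤ; _*_; _+_)
  open import Data.Integer.Tactic.RingSolver using (solve-∀)
  import Data.Fin as Fin
  open import Data.Vec using (toList)
  open import Data.List using (List; _∷_)
  open import Data.List.Relation.Unary.Any using (here; there)
  open import Data.Product using (Σ; _×_; _,_; proj₁; proj₂)
  open import Data.Sum using (_⊎_; inj₁; inj₂)
  open import Data.Empty using (⊥-elim)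
  open import Relation.Binary.PropositionalEquality
  open import Relation.Nullary using (¬_; yes; no)
  open import Function using (_∘_)
  open IntegerUnits
  open VectorAlgebra
  open LinearCombinations
  open Lines
  open Coordinates

  private
    C : ℤ^ d → ℤ^ p
    C = coord vs B

  private module Apex where
    s₀ s₁ s₂ : ℤ
    s₀ = proj₁ rel
    s₁ = proj₁ (proj₂ rel)
    s₂ = proj₁ (proj₂ (proj₂ rel))
    u₀ : IsUnit s₀
    u₀ = proj₁ (proj₂ (proj₂ (proj₂ rel)))
    u₁ : IsUnit s₁
    u₁ = proj₁ (proj₂ (proj₂ (proj₂ (proj₂ rel))))
    u₂ : IsUnit s₂
    u₂ = proj₁ (proj₂ (proj₂ (proj₂ (proj₂ (proj₂ rel)))))
    relation : ∀ r → combo s₀ s₁ s₂ (lookup (C v₀) r) (lookup (std i) r) (lookup (std j) r) ≡ 0ℤ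
    relation = relation-lookup s₀ s₁ s₂ (C v₀) (std i) (std j)
      (trans (sym (cong₂ _⊕_ (cong (λ v → s₀ · C v₀ ⊕ s₁ · v) (coord-basis vs B i))
                             (cong (s₂ ·_) (coord-basis vs B j))))
             (coord-relation vs B {s₀} {s₁} {s₂} (proj₂ (proj₂ (proj₂ (proj₂ (proj₂ (proj₂ rel))))))))
  open Apex using (s₀; s₁; s₂; u₀; u₁; u₂)

  apex-off : ∀ r → r ≢ i → r ≢ j → lookup (C v₀) r ≡ 0ℤ
  apex-off r r≢i r≢j = unit-cancel _ u₀ (trans (sym (drop s₀ s₁ s₂ _))
    (trans (cong₂ (combo s₀ s₁ s₂ _) (sym (std-diff r≢i)) (sym (std-diff r≢j))) (Apex.relation r)))
    where
    drop : ∀ a b c x → a * x + b * 0ℤ + c * 0ℤ ≡ a * x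
    drop = solve-∀

  apex-at-i : IsUnit (lookup (C v₀) i)
  apex-at-i = unit-solve _ u₀ u₁ (trans (sym (drop s₀ s₁ s₂ _))
    (trans (cong₂ (combo s₀ s₁ s₂ _) (sym (std-same i)) (sym (std-diff i≢j))) (Apex.relation i)))
    where
    drop : ∀ a b c x → a * x + b * 1ℤ + c * 0ℤ ≡ a * x + b
    drop = solve-∀

  apex-at-j : IsUnit (lookup (C v₀) j)
  apex-at-j = unit-solve _ u₀ u₂ (trans (sym (drop s₀ s₁ s₂ _))
    (trans (cong₂ (combo s₀ s₁ s₂ _) (sym (std-diff (λ j≡i → i≢j (sym j≡i)))) (sym (std-same j))) (Apex.relation j)))
    where
    drop : ∀ a b c x → a * x + b * 0ℤ + c * 1ℤ ≡ a * x + c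
    drop = solve-∀

  data FrameLine : Set where
    apex   : FrameLine
    member : Fin p → FrameLine

  representative : FrameLine → ℤ^ d
  representative apex       = v₀
  representative (member k) = lookup vs k

  frameCoord : FrameLine → ℤ^ p
  frameCoord apex       = C v₀
  frameCoord (member k) = std k

  coord-representative : ∀ T → C (representative T) ≡ frameCoord T
  coord-representative apex       = refl
  coord-representative (member k) = coord-basis vs B k

  Frame : List (ℤ^ d)
  Frame = v₀ ∷ toList vs

  onFrameLine : ∀ {y} → y ∈ₗ Frame → Σ FrameLine (λ T → SameLine (representative T) y)
  onFrameLine (_ , here refl , s) = apex , s
  onFrameLine (_ , there u∈ , s) with ∈toList⇒lookup vs u∈
  ... | k , refl = member k , s

  SignedCoord : FrameLine → ℤ^ d → Set
  SignedCoord T y = Σ ℤ (λ ε → IsUnit ε × C y ≡ ε · frameCoord T)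

  coord-onFrameLine : ∀ T {y} → SameLine (representative T) y → SignedCoord T y
  coord-onFrameLine T (inj₁ refl) = 1ℤ , inj₁ refl , trans (coord-representative T) (sym (1-· _))
  coord-onFrameLine T {y} (inj₂ r≡-y) = -1ℤ , inj₂ refl , (begin
    C y                          ≡⟨ cong C (trans (sym (neg-involutive y)) (cong neg (sym r≡-y))) ⟩
    C (neg (representative T))   ≡⟨ coord-neg vs B _ ⟩
    -1ℤ · C (representative T)   ≡⟨ cong (-1ℤ ·_) (coord-representative T) ⟩
    -1ℤ · frameCoord T           ∎)
    where open ≡-Reasoning

  Related : ℤ → ℤ → ℤ → FrameLine → FrameLine → FrameLine → Set
  Related a b c T₁ T₂ T₃ =
    ∀ r → combo a b c (lookup (frameCoord T₁) r) (lookup (frameCoord T₂) r) (lookup (frameCoord T₃) r) ≡ 0ℤ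

  related-swap₁₂ : ∀ a b c T₁ T₂ T₃ → Related a b c T₁ T₂ T₃ → Related b a c T₂ T₁ T₃
  related-swap₁₂ a b c T₁ T₂ T₃ h r = trans (sym (combo-swap₁₂ a b c _ _ _)) (h r)

  related-swap₁₃ : ∀ a b c T₁ T₂ T₃ → Related a b c T₁ T₂ T₃ → Related c b a T₃ T₂ T₁
  related-swap₁₃ a b c T₁ T₂ T₃ h r = trans (sym (combo-swap₁₃ a b c _ _ _)) (h r)

  related-swap₂₃ : ∀ a b c T₁ T₂ T₃ → Related a b c T₁ T₂ T₃ → Related a c b T₁ T₃ T₂
  related-swap₂₃ a b c T₁ T₂ T₃ h r = trans (sym (combo-swap₂₃ a b c _ _ _)) (h r)

  module _ {a b c : ℤ} (ua : IsUnit a) (ub : IsUnit b) (uc : IsUnit c) where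

    -- three basis lines are never related: look at the coordinate of the first
    -- one that is not shared by all three
    members-unrelated : ∀ k l r → ¬ Related a b c (member k) (member l) (member r)
    members-unrelated k l r h with k Fin.≟ l | k Fin.≟ r
    ... | yes refl | yes refl = combo-units≢0 ua ub uc (inj₁ refl) (inj₁ refl) (inj₁ refl)
          (trans (sym (combo-cong a b c (std-same k) (std-same k) (std-same k))) (h k))
    ... | yes refl | no k≢r = combo-lonely₃ a b 1ℤ uc (inj₁ refl)
          (trans (sym (combo-cong a b c (std-diff (k≢r ∘ sym)) (std-diff (k≢r ∘ sym)) (std-same r))) (h r))
    ... | no k≢l | yes refl = combo-lonely₂ a c 1ℤ ub (inj₁ refl)
          (trans (sym (combo-cong a b c (std-diff (k≢l ∘ sym)) (std-same l) (std-diff (k≢l ∘ sym)))) (h l))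
    ... | no k≢l | no k≢r = combo-lonely₁ b c 1ℤ ua (inj₁ refl)
          (trans (sym (combo-cong a b c (std-same k) (std-diff k≢l) (std-diff k≢r))) (h k))

    apex-apex-unrelated : ∀ k → ¬ Related a b c apex apex (member k)
    apex-apex-unrelated k h with k Fin.≟ i | k Fin.≟ j
    ... | yes refl | _ = combo-units≢0 ua ub uc apex-at-i apex-at-i (inj₁ refl)
          (trans (sym (cong (combo a b c _ _) (std-same k))) (h k))
    ... | no _ | yes refl = combo-units≢0 ua ub uc apex-at-j apex-at-j (inj₁ refl)
          (trans (sym (cong (combo a b c _ _) (std-same k))) (h k))
    ... | no k≢i | no k≢j = combo-lonely₃ a b 1ℤ uc (inj₁ refl)
          (trans (sym (combo-cong a b c (apex-off k k≢i k≢j) (apex-off k k≢i k≢j) (std-same k))) (h k))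

    apex³-unrelated : ¬ Related a b c apex apex apex
    apex³-unrelated h = combo-units≢0 ua ub uc apex-at-i apex-at-i apex-at-i (h i)

    -- if v₀ is related to bₖ and bₗ then {i, j} ⊆ {k, l}: at the coordinate
    -- i (resp. j) the unit coordinate of v₀ must be cancelled
    apex-members-related : ∀ k l → Related a b c apex (member k) (member l) →
                           (i ≡ k ⊎ i ≡ l) × (j ≡ k ⊎ j ≡ l)
    apex-members-related k l h = cancelled i apex-at-i , cancelled j apex-at-j
      where
      cancelled : ∀ t → IsUnit (lookup (C v₀) t) → t ≡ k ⊎ t ≡ l
      cancelled t ut with t Fin.≟ k | t Fin.≟ l
      ... | yes t≡k | _       = inj₁ t≡k
      ... | no _    | yes t≡l = inj₂ t≡l
      ... | no t≢k  | no t≢l  = ⊥-elim (combo-lonely₁ b c _ ua ut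
            (trans (sym (cong₂ (combo a b c _) (std-diff t≢k) (std-diff t≢l))) (h t)))

  _∈₃_ : FrameLine → FrameLine × FrameLine × FrameLine → Set
  X ∈₃ (T₁ , T₂ , T₃) = X ≡ T₁ ⊎ X ≡ T₂ ⊎ X ≡ T₃

  rigidity : ∀ {a b c} → IsUnit a → IsUnit b → IsUnit c → ∀ T₁ T₂ T₃ → Related a b c T₁ T₂ T₃ →
             apex ∈₃ (T₁ , T₂ , T₃) × member i ∈₃ (T₁ , T₂ , T₃) × member j ∈₃ (T₁ , T₂ , T₃)
  rigidity {a} {b} {c} ua ub uc apex       apex       apex       h = ⊥-elim (apex³-unrelated ua ub uc h)
  rigidity {a} {b} {c} ua ub uc apex       apex       (member k) h = ⊥-elim (apex-apex-unrelated ua ub uc k h)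
  rigidity {a} {b} {c} ua ub uc apex       (member k) apex       h =
    ⊥-elim (apex-apex-unrelated ua uc ub k (related-swap₂₃ a b c apex (member k) apex h))
  rigidity {a} {b} {c} ua ub uc (member k) apex       apex       h =
    ⊥-elim (apex-apex-unrelated uc ub ua k (related-swap₁₃ a b c (member k) apex apex h))
  rigidity {a} {b} {c} ua ub uc (member k) (member l) (member r) h = ⊥-elim (members-unrelated ua ub uc k l r h)
  rigidity {a} {b} {c} ua ub uc apex (member k) (member l) h with apex-members-related ua ub uc k l h
  ... | i∈ , j∈ = inj₁ refl , place i∈ , place j∈
    where
    place : ∀ {t} → t ≡ k ⊎ t ≡ l → member t ∈₃ (apex , member k , member l)
    place (inj₁ refl) = inj₂ (inj₁ refl)
    place (inj₂ refl) = inj₂ (inj₂ refl)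
  rigidity {a} {b} {c} ua ub uc (member k) apex (member l) h
    with apex-members-related ub ua uc k l (related-swap₁₂ a b c (member k) apex (member l) h)
  ... | i∈ , j∈ = inj₂ (inj₁ refl) , place i∈ , place j∈
    where
    place : ∀ {t} → t ≡ k ⊎ t ≡ l → member t ∈₃ (member k , apex , member l)
    place (inj₁ refl) = inj₁ refl
    place (inj₂ refl) = inj₂ (inj₂ refl)
  rigidity {a} {b} {c} ua ub uc (member k) (member l) apex h
    with apex-members-related uc ub ua l k (related-swap₁₃ a b c (member k) (member l) apex h)
  ... | i∈ , j∈ = inj₂ (inj₂ refl) , place i∈ , place j∈
    where
    place : ∀ {t} → t ≡ l ⊎ t ≡ k → member t ∈₃ (member k , member l , apex)
    place (inj₁ refl) = inj₂ (inj₁ refl)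
    place (inj₂ refl) = inj₁ refl

  module _ (S : List (ℤ^ d)) (S⊆Frame : ∀ {y} → y ∈ₗ S → y ∈ₗ Frame) where

    relation-closure : ∀ {x y z} → x ∈ₗ S → y ∈ₗ S → z ∈ₗ S → SignedSumZero x y z →
                       v₀ ∈ₗ S × lookup vs i ∈ₗ S × lookup vs j ∈ₗ S
    relation-closure {x} {y} {z} x∈ y∈ z∈ (t₀ , t₁ , t₂ , ut₀ , ut₁ , ut₂ , eq) =
      retrieve (proj₁ covered) , retrieve (proj₁ (proj₂ covered)) , retrieve (proj₂ (proj₂ covered))
      where
      Tx Ty Tz : FrameLine
      Tx = proj₁ (onFrameLine (S⊆Frame x∈))
      Ty = proj₁ (onFrameLine (S⊆Frame y∈))
      Tz = proj₁ (onFrameLine (S⊆Frame z∈))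
      sx : SameLine (representative Tx) x
      sx = proj₂ (onFrameLine (S⊆Frame x∈))
      sy : SameLine (representative Ty) y
      sy = proj₂ (onFrameLine (S⊆Frame y∈))
      sz : SameLine (representative Tz) z
      sz = proj₂ (onFrameLine (S⊆Frame z∈))
      εx : SignedCoord Tx x
      εx = coord-onFrameLine Tx sx
      εy : SignedCoord Ty y
      εy = coord-onFrameLine Ty sy
      εz : SignedCoord Tz z
      εz = coord-onFrameLine Tz sz
      relation : (t₀ * proj₁ εx) · frameCoord Tx ⊕ (t₁ * proj₁ εy) · frameCoord Ty
                   ⊕ (t₂ * proj₁ εz) · frameCoord Tz ≡ 0v
      relation = trans (cong₂ _⊕_ (cong₂ _⊕_ (absorb t₀ x Tx εx) (absorb t₁ y Ty εy)) (absorb t₂ z Tz εz))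
                       (coord-relation vs B {t₀} {t₁} {t₂} eq)
        where
        absorb : ∀ t y T (ε : SignedCoord T y) →
                 (t * proj₁ ε) · frameCoord T ≡ t · C y
        absorb t y T (ε , _ , Cy≡) = trans (*-assoc-· t ε _) (cong (t ·_) (sym Cy≡))
      covered : apex ∈₃ (Tx , Ty , Tz) × member i ∈₃ (Tx , Ty , Tz) × member j ∈₃ (Tx , Ty , Tz)
      covered = rigidity (unit-* ut₀ (proj₁ (proj₂ εx))) (unit-* ut₁ (proj₁ (proj₂ εy)))
                         (unit-* ut₂ (proj₁ (proj₂ εz))) Tx Ty Tz
                         (relation-lookup (t₀ * proj₁ εx) (t₁ * proj₁ εy) (t₂ * proj₁ εz) (frameCoord Tx) (frameCoord Ty) (frameCoord Tz) relation)
      retrieve : ∀ {X} → X ∈₃ (Tx , Ty , Tz) → representative X ∈ₗ S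
      retrieve (inj₁ refl)        = ∈ₗ-sameLine x∈ (sameLine-sym sx)
      retrieve (inj₂ (inj₁ refl)) = ∈ₗ-sameLine y∈ (sameLine-sym sy)
      retrieve (inj₂ (inj₂ refl)) = ∈ₗ-sameLine z∈ (sameLine-sym sz)

    vanishes-off : ∀ {k y} → lookup vs i ∈ₗ S → lookup vs j ∈ₗ S → ¬ (lookup vs k ∈ₗ S) →
                   y ∈ₗ S → Vanishes vs B k y
    vanishes-off {k} bᵢ∈ bⱼ∈ bₖ∉ y∈ with onFrameLine (S⊆Frame y∈)
    ... | apex , s = vanishes-sameLine vs B s (apex-off k (λ { refl → bₖ∉ bᵢ∈ }) (λ { refl → bₖ∉ bⱼ∈ }))
    ... | member l , s = vanishes-sameLine vs B s (trans (cong (λ v → lookup v k) (coord-basis vs B l)) (std-diff k≢l))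
      where
      k≢l : k ≢ l
      k≢l refl = bₖ∉ (∈ₗ-sameLine y∈ (sameLine-sym s))

import Data.Nat as ℕ
open import Data.Nat using (ℕ)
open import Data.Integer as ℤ using (ℤ)
open import Data.List using (List)

module Retraction (m n : ℕ) (F : ℤ^ (m ℕ.+ n) → ℤ) (lin : IsLinear F) (σ : List (ℤ^ (m ℕ.+ n)))
                  (w : ℤ^ (m ℕ.+ n)) (w∈σ : w ∈ₗ σ) (N′ : ℕ) (Fw≡N : F w ≡ ℤ.+ ℕ.suc N′) where
  open import Data.Nat using (suc)
  open import Data.Integer using (+_; 0ℤ; -1ℤ; _*_; _+_; -_; ∣_∣)
  import Data.Integer.Properties as ℤP
  open import Data.Vec using (toList; tabulate)
  import Data.Vec.Properties as VP
  open import Data.List using (_∷_; _++_; map)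
  open import Data.List.Properties using (++-assoc)
  open import Data.List.Membership.Propositional using (_∈_)
  open import Data.List.Membership.Propositional.Properties using (∈-++⁺ˡ; ∈-++⁺ʳ; ∈-++⁻; ∈-map⁻)
  open import Data.List.Relation.Unary.All as All using (All; _∷_)
  import Data.List.Relation.Unary.All.Properties as AllP
  open import Data.List.Relation.Unary.Any using (here; there)
  open import Data.Product using (Σ; ∃-syntax; _×_; _,_; proj₁; proj₂)
  open import Data.Sum using (_⊎_; inj₁; inj₂)
  open import Data.Empty using (⊥-elim)
  open import Relation.Binary.PropositionalEquality
  open import Relation.Nullary using (¬_; Dec; yes; no)
  open IntegerUnits
  open VectorAlgebra
  open LinearCombinations
  open Lines
  open Coordinates
  open ShearedBasis
  open SymmetricQuotient

  D : ℕ
  D = m ℕ.+ n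

  E : List (ℤ^ D)
  E = toList (es m n)

  steps : ℤ^ D → ℤ
  steps v = quot N′ (F v)

  π : ℤ^ D → ℤ^ D
  π v = shear w v (steps v)

  π-neg : ∀ v → π (neg v) ≡ neg (π v)
  π-neg v = trans (cong (shear w (neg v)) steps-odd) (sym (neg-shear v w (steps v)))
    where
    F-neg : F (neg v) ≡ - F v
    F-neg = trans (cong F (neg≡-1· v)) (trans (proj₂ lin -1ℤ v) (ℤP.-1*i≡-i (F v)))
    steps-odd : steps (neg v) ≡ - steps v
    steps-odd = trans (cong (quot N′) F-neg) (quot-odd N′ (F v))

  π-sameLine : ∀ {u v} → SameLine u v → SameLine (π u) (π v)
  π-sameLine (inj₁ refl) = inj₁ refl
  π-sameLine {v = v} (inj₂ refl) = inj₂ (π-neg v)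

  -- π lands in the strip: F(π v) = F v + q(F v)·N is the symmetric remainder
  π-in-strip : ∀ v → ∣ F (π v) ∣ ℕ.< suc N′
  π-in-strip v = subst (λ e → ∣ e ∣ ℕ.< suc N′) (sym F-π) (quot-remainder N′ (F v))
    where
    F-π : F (π v) ≡ F v + steps v * + suc N′
    F-π = trans (proj₁ lin v (steps v · w)) (cong (λ e → F v + e) (trans (proj₂ lin (steps v) w) (cong (steps v *_) Fw≡N)))

  π-fixes-strip : ∀ v → ∣ F v ∣ ℕ.< suc N′ → π v ≡ v
  π-fixes-strip v lt = trans (cong (shear w v) (quot-strip N′ (F v) lt)) (⊕-0· v w)

  additive-relation : IsAdditive m n σ →
    ∃[ x ] ∃[ y ] ∃[ z ] (x ∈ₗ (σ ++ E) × y ∈ₗ (σ ++ E) × z ∈ₗ (σ ++ E) × SignedSumZero x y z)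
  additive-relation (_ , u₀ , us , (_ , ⊆σ) , _ , inj₁ (i , j , _ , r)) =
    u₀ , lookup us i , lookup us j , ∈ₗ-++⁺ˡ (⊆σ (here refl)) ,
    ∈ₗ-++⁺ˡ (⊆σ (there (lookup∈toList us i))) , ∈ₗ-++⁺ˡ (⊆σ (there (lookup∈toList us j))) , r
  additive-relation (_ , u₀ , us , (_ , ⊆σ) , _ , inj₂ (i , k , r)) =
    u₀ , lookup us i , lookup (es m n) k , ∈ₗ-++⁺ˡ (⊆σ (here refl)) ,
    ∈ₗ-++⁺ˡ (⊆σ (there (lookup∈toList us i))) , ∈ₗ-++⁺ʳ σ (∈⇒∈ₗ (lookup∈toList (es m n) k)) , r

  -- The image of one simplex τ of the link.  The parameters unpack
  -- τ ∈ Link (BA m n) σ: an augmented frame {v₀, b₁,…,b_D} containing the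
  -- lines of τ ∪ σ ∪ E.
  module ImageOfSimplex (additive : IsAdditive m n σ) (τ : List (ℤ^ D))
      (τσ-off-E : All (NotInSpanE m n) (τ ++ σ)) (τσE-primitive : All IsPrimitive ((τ ++ σ) ++ E))
      (v₀ : ℤ^ D) (vs : Vec (ℤ^ D) D) (B : IsBasis vs) (i j : Fin D) (i≢j : i ≢ j)
      (rel : SignedSumZero v₀ (lookup vs i) (lookup vs j))
      (in-frame : ((τ ++ σ) ++ E) ⊆ₗ (v₀ ∷ toList vs)) (τ#σ : Disjointₗ τ σ) where

    open FrameRelations vs B v₀ i j i≢j rel

    S : List (ℤ^ D)
    S = σ ++ E

    S⊆τσE : ∀ {y} → y ∈ S → y ∈ (τ ++ σ) ++ E
    S⊆τσE {y} y∈ = subst (y ∈_) (sym (++-assoc τ σ E)) (∈-++⁺ʳ τ y∈)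

    S⊆Frame : ∀ {y} → y ∈ₗ S → y ∈ₗ Frame
    S⊆Frame (u , u∈ , s) = ∈ₗ-sameLine (in-frame (S⊆τσE u∈)) s

    w∈S : w ∈ₗ S
    w∈S = ∈ₗ-++⁺ˡ w∈σ

    -- σ is additive, so S carries a signed relation and rigidity applies
    apex-bᵢ-bⱼ∈S : v₀ ∈ₗ S × lookup vs i ∈ₗ S × lookup vs j ∈ₗ S
    apex-bᵢ-bⱼ∈S with additive-relation additive
    ... | x , y , z , x∈ , y∈ , z∈ , r = relation-closure S S⊆Frame x∈ y∈ z∈ r

    bᵢ∈S : lookup vs i ∈ₗ S
    bᵢ∈S = proj₁ (proj₂ apex-bᵢ-bⱼ∈S)

    bⱼ∈S : lookup vs j ∈ₗ S
    bⱼ∈S = proj₂ (proj₂ apex-bᵢ-bⱼ∈S)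

    S-vanishes-off-S : ∀ {k y} → ¬ (lookup vs k ∈ₗ S) → y ∈ₗ S → Vanishes vs B k y
    S-vanishes-off-S bₖ∉ = vanishes-off S S⊆Frame bᵢ∈S bⱼ∈S bₖ∉

    -- the shears: bₖ is moved by π exactly when ⟨bₖ⟩ ∉ S
    shearCoeff : ∀ {k} → Dec (lookup vs k ∈ₗ S) → ℤ
    shearCoeff (yes _) = 0ℤ
    shearCoeff {k} (no _) = steps (lookup vs k)

    γ : Vec ℤ D
    γ = tabulate (λ k → shearCoeff (∈ₗ-dec (lookup vs k) S))

    γ-on-S : ∀ {k} → lookup vs k ∈ₗ S → lookup γ k ≡ 0ℤ
    γ-on-S {k} bₖ∈ rewrite VP.lookup∘tabulate (λ k → shearCoeff (∈ₗ-dec (lookup vs k) S)) k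
      with ∈ₗ-dec (lookup vs k) S
    ... | yes _   = refl
    ... | no bₖ∉ = ⊥-elim (bₖ∉ bₖ∈)

    γ-off-S : ∀ {k} → ¬ (lookup vs k ∈ₗ S) → lookup γ k ≡ steps (lookup vs k)
    γ-off-S {k} bₖ∉ rewrite VP.lookup∘tabulate (λ k → shearCoeff (∈ₗ-dec (lookup vs k) S)) k
      with ∈ₗ-dec (lookup vs k) S
    ... | yes bₖ∈ = ⊥-elim (bₖ∉ bₖ∈)
    ... | no _    = refl

    disjoint : DisjointSupport (coord vs B w) γ
    disjoint k with ∈ₗ-dec (lookup vs k) S
    ... | yes bₖ∈ = inj₁ (γ-on-S bₖ∈)
    ... | no bₖ∉  = inj₂ (S-vanishes-off-S bₖ∉ w∈S)

    open Shearing vs B w (coord vs B w) γ (coord-spec vs B w) disjoint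

    sheared-on-S : ∀ {k} → lookup vs k ∈ₗ S → lookup sheared k ≡ lookup vs k
    sheared-on-S {k} bₖ∈ = trans (lookup-sheared k) (trans (cong (λ g → shear w (lookup vs k) g) (γ-on-S bₖ∈)) (⊕-0· _ w))

    sheared-off-S : ∀ {k} → ¬ (lookup vs k ∈ₗ S) → lookup sheared k ≡ π (lookup vs k)
    sheared-off-S {k} bₖ∉ = trans (lookup-sheared k) (cong (shear w (lookup vs k)) (γ-off-S bₖ∉))

    sheared-nonvanishing : ∀ {k} → ¬ (lookup vs k ∈ₗ S) → ¬ Vanishes vs B k (lookup sheared k)
    sheared-nonvanishing {k} bₖ∉ z = unit≢0 (inj₁ refl) (trans (sym bₖ-coord) bₖ-vanishes)
      where
      bₖ-coord : lookup (coord vs B (lookup vs k)) k ≡ ℤ.1ℤ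
      bₖ-coord = trans (cong (λ v → lookup v k) (coord-basis vs B k)) (std-same k)
      bₖ-vanishes : Vanishes vs B k (lookup vs k)
      bₖ-vanishes = subst (Vanishes vs B k) (shear-cancel (lookup vs k) w (lookup γ k))
        (vanishes-⊕ vs B (subst (Vanishes vs B k) (lookup-sheared k) z) (vanishes-· vs B (- lookup γ k) (S-vanishes-off-S bₖ∉ w∈S)))

    τ-off-S : ∀ {v} → v ∈ τ → ¬ (v ∈ₗ S)
    τ-off-S {v} v∈ v∈S with ∈ₗ-++⁻ σ v∈S
    ... | inj₁ v∈σ = τ#σ v (∈⇒∈ₗ v∈) v∈σ
    ... | inj₂ (u , u∈E , s) with ∈toList⇒lookup (es m n) u∈E
    ...   | l , refl = All.lookup τσ-off-E (∈-++⁺ˡ v∈) (on-eₗ-line s)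
      where
      on-eₗ-line : SameLine (lookup (es m n) l) v → ∃[ c ] lincomb (es m n) c ≡ v
      on-eₗ-line (inj₁ eₗ≡v) = std l , trans (lincomb-std (es m n) l) eₗ≡v
      on-eₗ-line (inj₂ eₗ≡-v) = -1ℤ · std l , (begin
        lincomb (es m n) (-1ℤ · std l)   ≡⟨ lincomb-· (es m n) -1ℤ (std l) ⟩
        -1ℤ · lincomb (es m n) (std l)   ≡⟨ cong (-1ℤ ·_) (trans (lincomb-std (es m n) l) eₗ≡-v) ⟩
        -1ℤ · neg v                      ≡⟨ sym (neg≡-1· (neg v)) ⟩
        neg (neg v)                      ≡⟨ neg-involutive v ⟩
        v                                ∎)
        where open ≡-Reasoning

    τ-on-sheared : ∀ {v} → v ∈ τ → Σ (Fin D) (λ k → ¬ (lookup vs k ∈ₗ S) × SameLine (lookup sheared k) (π v))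
    τ-on-sheared {v} v∈ with onFrameLine (in-frame (∈-++⁺ˡ (∈-++⁺ˡ v∈)))
    ... | apex , s     = ⊥-elim (τ-off-S v∈ (∈ₗ-sameLine (proj₁ apex-bᵢ-bⱼ∈S) s))
    ... | member k , s = k , bₖ∉ , subst (λ u → SameLine u (π v)) (sym (sheared-off-S bₖ∉)) (π-sameLine s)
      where
      bₖ∉ : ¬ (lookup vs k ∈ₗ S)
      bₖ∉ bₖ∈ = τ-off-S v∈ (∈ₗ-sameLine bₖ∈ s)

    -- π v is not on a line of S: it would vanish along its own sheared basis vector
    π-off-S : ∀ {v y} → v ∈ τ → y ∈ₗ S → ¬ SameLine (π v) y
    π-off-S v∈ y∈ s with τ-on-sheared v∈
    ... | k , bₖ∉ , s′ = sheared-nonvanishing bₖ∉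
      (vanishes-sameLine vs B (sameLine-sym (sameLine-trans s′ s)) (S-vanishes-off-S bₖ∉ y∈))

    π-off-E : ∀ {v} → v ∈ τ → NotInSpanE m n (π v)
    π-off-E v∈ (c , Σce≡πv) with τ-on-sheared v∈
    ... | k , bₖ∉ , s = sheared-nonvanishing bₖ∉ (vanishes-sameLine vs B (sameLine-sym s)
      (subst (Vanishes vs B k) Σce≡πv (vanishes-lincomb vs B (es m n)
        (λ l → S-vanishes-off-S bₖ∉ (∈ₗ-++⁺ʳ σ (∈⇒∈ₗ (lookup∈toList (es m n) l)))) c)))

    π-primitive : ∀ {v} → v ∈ τ → IsPrimitive (π v)
    π-primitive v∈ with τ-on-sheared v∈
    ... | k , _ , s = primitive-sameLine s (basis-primitive sheared sheared-basis k)

    image : List (ℤ^ D)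
    image = map π τ

    image-split : ∀ {y} → y ∈ (image ++ σ) ++ E → (∃[ v ] (v ∈ τ × y ≡ π v)) ⊎ y ∈ S
    image-split {y} y∈ with ∈-++⁻ image (subst (y ∈_) (++-assoc image σ E) y∈)
    ... | inj₁ y∈image = inj₁ (∈-map⁻ π y∈image)
    ... | inj₂ y∈S     = inj₂ y∈S

    image-in-frame : ((image ++ σ) ++ E) ⊆ₗ (v₀ ∷ toList sheared)
    image-in-frame y∈ with image-split y∈
    ... | inj₁ (v , v∈ , refl) with τ-on-sheared v∈
    ...   | k , _ , s = lookup sheared k , there (lookup∈toList sheared k) , s
    image-in-frame {y} y∈ | inj₂ y∈S with onFrameLine (S⊆Frame (∈⇒∈ₗ y∈S))
    ... | apex , s     = v₀ , here refl , s
    ... | member k , s = lookup sheared k , there (lookup∈toList sheared k) ,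
          subst (λ u → SameLine u y) (sym (sheared-on-S (∈ₗ-sameLine (∈⇒∈ₗ y∈S) (sameLine-sym s)))) s

    image-relation : SignedSumZero v₀ (lookup sheared i) (lookup sheared j)
    image-relation = subst₂ (SignedSumZero v₀) (sym (sheared-on-S bᵢ∈S)) (sym (sheared-on-S bⱼ∈S)) rel

    image-primitive : All IsPrimitive ((image ++ σ) ++ E)
    image-primitive = All.tabulate λ y∈ → primitive-of (image-split y∈)
      where
      primitive-of : ∀ {y} → (∃[ v ] (v ∈ τ × y ≡ π v)) ⊎ y ∈ S → IsPrimitive y
      primitive-of (inj₁ (v , v∈ , refl)) = π-primitive v∈
      primitive-of (inj₂ y∈S)             = All.lookup τσE-primitive (S⊆τσE y∈S)

    image-off-E : All (NotInSpanE m n) (image ++ σ)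
    image-off-E = AllP.++⁺ (AllP.map⁺ (All.tabulate π-off-E)) (AllP.++⁻ʳ τ τσ-off-E)

    image-disjoint : Disjointₗ image σ
    image-disjoint y (u , u∈ , u~y) y∈σ with ∈-map⁻ π u∈
    ... | v , v∈ , refl = π-off-S v∈ (∈ₗ-++⁺ˡ y∈σ) u~y

    image-in-link : Below F (suc N′) (Link (BA m n) σ) image
    image-in-link =
      ( ( image-off-E
        , image-primitive , v₀ , sheared , (sheared-basis , i , j , i≢j , image-relation) , image-in-frame)
      , image-disjoint)
      , AllP.map⁺ (All.universal π-in-strip τ)

  π-simplicial : IsAdditive m n σ → ∀ τ → Link (BA m n) σ τ → Below F (suc N′) (Link (BA m n) σ) (map π τ)
  π-simplicial additive τ ((τσ-off-E , τσE-primitive , v₀ , vs , (B , i , j , i≢j , rel) , in-frame) , τ#σ) =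
    ImageOfSimplex.image-in-link additive τ τσ-off-E τσE-primitive v₀ vs B i j i≢j rel in-frame τ#σ

  retraction : IsAdditive m n σ →
               IsSimplicialRetraction (Link (BA m n) σ) (Below F (suc N′) (Link (BA m n) σ)) π
  retraction additive =
    (λ _ _ _ → π-sameLine) , π-simplicial additive , λ { v (_ , lt ∷ _) → inj₁ (π-fixes-strip v lt) }

open import Data.Nat using (_+_; _≤_; _<_; suc)
open import Data.Integer using (+_)
open import Data.Product using (∃; _,_)

-- Lemma 4.16.
lemma4p16 : (n m : ℕ) → 2 ≤ n →
    (F : ℤ^ (m + n) → ℤ) → IsLinear F →
    (σ : List (ℤ^ (m + n))) → BA m n σ → IsAdditive m n σ →
    (w : ℤ^ (m + n)) → w ∈ₗ σ → (N : ℕ) → 0 < N → F w ≡ + N →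
    ∃ (λ π → IsSimplicialRetraction (Link (BA m n) σ) (Below F N (Link (BA m n) σ)) π)
lemma4p16 n m _ F lin σ _ additive w w∈σ (suc N′) _ Fw≡N =
  π , retraction additive
  where open Retraction m n F lin σ w w∈σ N′ Fw≡N
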